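{- (i) For every clear grand-coalition-first action model $M=(ST,AC,out_{AG},L)$, with determined successor function $suc$ and determined outcome functions $out_{\{a\}}$ ($a\in AG$), the tuple $(ST,AC,suc,\{out_{\{a\}}\}_{a\in AG},L)$ is a single-coalition-first action model, and the action model it determines coincides with the action model determined by $M$ (all outcome and availability functions for all coalitions agree). (ii) There is a single-coalition-first action model whose determined grand-coalition outcome function $out_{AG}$ is such that the grand-coalition-first action model $(ST,AC,out_{AG},L)$ is not clear.
   Context: $AG$ is a finite nonempty set of agents, $AP$ a countable set of atomic propositions. For a nonempty set $AC$ and $C\subseteq AG$, $JA_C$ is the set of functions $\sigma_C:C\to AC$ ($JA_\emptyset=\{\emptyset\}$); $\sigma_C\subseteq\sigma_{AG}$ means $\sigma_C$ is the restriction of $\sigma_{AG}$ to $C$; $\sigma_C|_{\{a\}}$ is the restriction to $\{a\}$. A grand-coalition-first action model is $(ST,AC,out_{AG},L)$ with $ST,AC$ nonempty, $out_{AG}:ST\times JA_{AG}\to\mathcal P(ST)$, $L:ST\to\mathcal P(AP)$. It determines $out_C(s,\sigma_C)=\bigcup\{out_{AG}(s,\sigma_{AG})\mid\sigma_C\subseteq\sigma_{AG}\}$, $av_C(s)=\{\sigma_C\in JA_C\mid out_C(s,\sigma_C)\neq\emptyset\}$, and $suc(s)=\bigcup\{out_{AG}(s,\sigma_{AG})\mid\sigma_{AG}\in JA_{AG}\}$. It is clear if for all $s$ and $\sigma_{AG}\neq\sigma'_{AG}$, $out_{AG}(s,\sigma_{AG})\cap out_{AG}(s,\sigma'_{AG})=\emptyset$.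 A single-coalition-first action model is $(ST,AC,suc,\{out_a\}_{a\in AG},L)$ with $suc:ST\to\mathcal P(ST)$ and $out_a:ST\times JA_{\{a\}}\to\mathcal P(ST)$ such that $\bigcup\{out_a(s,\sigma_a)\mid\sigma_a\in JA_{\{a\}}\}=suc(s)$ for every $s$. It determines $out_\emptyset(s,\emptyset)=suc(s)$, $out_C(s,\sigma_C)=\bigcap\{out_a(s,\sigma_C|_{\{a\}})\mid a\in C\}$ for nonempty $C$, and $av_C(s)=\{\sigma_C\mid out_C(s,\sigma_C)\neq\emptyset\}$. -}

module Defs where

open import Level using (0ℓ)
open import Data.Nat using (ℕ; suc)
open import Data.Fin using (Fin)
open import Data.Fin.Subset using (Subset; _∈_; ⁅_⁆; Nonempty)
open import Data.Fin.Subset.Properties using (nonempty?; x∈⁅y⁆⇒x≡y)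
open import Data.Product using (Σ; ∃; _×_; _,_)
open import Relation.Nullary using (¬_; yes; no)
open import Relation.Unary using (Pred; _≐_)
open import Relation.Binary.PropositionalEquality using (_≡_; subst; sym)

-- Agents: AG = Fin (suc n), a finite nonempty set.
-- Coalitions: subsets C ⊆ AG, i.e. Subset (suc n).
-- Sets of states: predicates Pred ST 0ℓ (P(ST)).

module _ {n : ℕ} (AC : Set) where

  Agent : Set
  Agent = Fin (suc n)

  Coalition : Set
  Coalition = Subset (suc n)

  JA : Coalition → Set
  JA C = (a : Agent) → a ∈ C → AC

  JAAG : Set
  JAAG = Agent → AC

  _⊑_ : {C : Coalition} → JA C → JAAG → Set
  σC ⊑ σAG = ∀ a (p : a ∈ _) → σC a p ≡ σAG a

  restrict1 : {C : Coalition} → JA C → (a : Agent) → a ∈ C → JA ⁅ a ⁆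
  restrict1 {C} σC a a∈C b b∈a = σC b (subst (_∈ C) (sym (x∈⁅y⁆⇒x≡y a b∈a)) a∈C)

record GCF (n : ℕ) (AP : Set) : Set₁ where
  field
    ST     : Set
    AC     : Set
    st₀    : ST          -- ST nonempty
    ac₀    : AC          -- AC nonempty
    outAG  : ST → JAAG {n} AC → Pred ST 0ℓ
    L      : ST → Pred AP 0ℓ

module GCFDet {n : ℕ} {AP : Set} (M : GCF n AP) where
  open GCF M

  out : (C : Coalition {n} AC) → ST → JA AC C → Pred ST 0ℓ
  out C s σC t = ∃ λ (σAG : JAAG AC) → _⊑_ AC σC σAG × t ∈' outAG s σAG
    where _∈'_ : ST → Pred ST 0ℓ → Set
          x ∈' P = P x

  av : (C : Coalition {n} AC) → ST → Pred (JA AC C) 0ℓ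
  av C s σC = ¬ (∀ t → ¬ out C s σC t)

  succ : ST → Pred ST 0ℓ
  succ s t = ∃ λ (σAG : JAAG AC) → outAG s σAG t

  -- clear: for σ_AG ≠ σ'_AG, out_AG(s,σ_AG) ∩ out_AG(s,σ'_AG) = ∅
  -- (stated constructively: a common outcome forces σ_AG, σ'_AG to agree pointwise)
  Clear : Set
  Clear = ∀ s (σ σ' : JAAG AC) t → outAG s σ t → outAG s σ' t → ∀ a → σ a ≡ σ' a

IsSCF : {n : ℕ} (ST AC : Set) → (ST → Pred ST 0ℓ)
      → ((a : Fin (suc n)) → ST → JA AC ⁅ a ⁆ → Pred ST 0ℓ) → Set
IsSCF {n} ST AC sucS outA =
  ∀ (a : Fin (suc n)) s → (λ t → ∃ λ (σa : JA AC ⁅ a ⁆) → outA a s σa t) ≐ sucS s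

record SCF (n : ℕ) (AP : Set) : Set₁ where
  field
    ST    : Set
    AC    : Set
    st₀   : ST
    ac₀   : AC
    sucS  : ST → Pred ST 0ℓ
    outA  : (a : Fin (suc n)) → ST → JA AC ⁅ a ⁆ → Pred ST 0ℓ
    L     : ST → Pred AP 0ℓ
    isSCF : IsSCF ST AC sucS outA

module SCFDet {n : ℕ} {ST AC : Set} (sucS : ST → Pred ST 0ℓ)
              (outA : (a : Fin (suc n)) → ST → JA AC ⁅ a ⁆ → Pred ST 0ℓ) where

  out : (C : Coalition {n} AC) → ST → JA AC C → Pred ST 0ℓ
  out C s σC with nonempty? C
  ... | yes _ = λ t → ∀ a (p : a ∈ C) → outA a s (restrict1 AC σC a p) t
  ... | no  _ = sucS s

  av : (C : Coalition {n} AC) → ST → Pred (JA AC C) 0ℓ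
  av C s σC = ¬ (∀ t → ¬ out C s σC t)

module SCFDetAG {n : ℕ} {AP : Set} (N : SCF n AP) where
  open SCF N
  open import Data.Fin.Subset using (⊤)
  outAG : ST → JAAG {n} AC → Pred ST 0ℓ
  outAG s σ = SCFDet.out sucS outA ⊤ s (λ a _ → σ a)

  toGCF : GCF n AP
  toGCF = record { ST = ST ; AC = AC ; st₀ = st₀ ; ac₀ = ac₀ ; outAG = outAG ; L = L }

{-# OPTIONS --safe #-}
-- (i) Clarity makes the outcome of a coalition the intersection of the outcomes of its members:
-- if t is reached both by an extension of σ_C|_{a} and by an extension of σ_C|_{a₀}, clarity
-- forces the two extensions to agree, so a single extension of σ_C reaches t.
-- (ii) A model in which every action of every agent may lead to every state is not clear as soon
-- as there are two different actions.
module Submission where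

open import Defs
open import Level using (0ℓ)
open import Data.Nat using (ℕ; suc)
open import Data.Fin using (Fin; zero)
open import Data.Fin.Subset using (Subset; _∈_; ⁅_⁆; Nonempty; ⊤)
open import Data.Fin.Subset.Properties using (nonempty?; x∈⁅x⁆)
open import Data.Vec.Properties.WithK using ([]=-irrelevant)
open import Data.Bool using (Bool; true; false)
open import Data.Unit using (tt) renaming (⊤ to Unit)
open import Data.Product using (Σ; _×_; _,_)
open import Function.Bundles using (_⇔_; mk⇔)
open import Relation.Nullary using (¬_; yes; no; contradiction)
open import Relation.Unary using (Pred; _≐_; Empty; Universal; U; ∅)
open import Relation.Binary.PropositionalEquality using (_≡_; _≢_; refl; sym; trans; cong)

¬Empty-resp-≐ : ∀ {A : Set} {P Q : Pred A 0ℓ} → P ≐ Q → (¬ Empty P) ⇔ (¬ Empty Q)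
¬Empty-resp-≐ (P⊆Q , Q⊆P) =
  mk⇔ (λ ¬∅P ∅Q → ¬∅P (λ x Px → ∅Q x (P⊆Q Px)))
      (λ ¬∅Q ∅P → ¬∅Q (λ x Qx → ∅P x (Q⊆P Qx)))

restrict1-self : ∀ {n} {AC : Set} {C : Subset (suc n)} (σC : JA AC C) {a} (p : a ∈ C) →
                 restrict1 AC σC a p a (x∈⁅x⁆ a) ≡ σC a p
restrict1-self σC {a} p = cong (σC a) ([]=-irrelevant _ p)

module _ {n : ℕ} {AP : Set} (M : GCF n AP) where
  open GCF M
  open GCFDet M

  isSCF-singletonOut : IsSCF ST AC succ (λ a → out ⁅ a ⁆)
  isSCF-singletonOut a s =
    (λ { (_ , σ , _ , t∈) → σ , t∈ })
    , (λ { (σ , t∈) → (λ b _ → σ b) , σ , (λ _ _ → refl) , t∈ })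

  succ≐out : ∀ {C} s (σC : JA AC C) → ¬ Nonempty C → succ s ≐ out C s σC
  succ≐out s σC C≠∅ =
    (λ { (σ , t∈) → σ , (λ a p → contradiction (a , p) C≠∅) , t∈ })
    , (λ { (σ , _ , t∈) → σ , t∈ })

  out-restrict1 : ∀ {C s t} {σC : JA AC C} a (p : a ∈ C) →
                  out C s σC t → out ⁅ a ⁆ s (restrict1 AC σC a p) t
  out-restrict1 a p (σ , σC⊑σ , t∈) = σ , (λ b _ → σC⊑σ b _) , t∈

  out-⋂-restrict1 : Clear → ∀ {C s t} {σC : JA AC C} {a₀} → a₀ ∈ C →
                    (∀ a (p : a ∈ C) → out ⁅ a ⁆ s (restrict1 AC σC a p) t) → out C s σC t
  out-⋂-restrict1 clear {s = s} {t} {σC} {a₀} a₀∈C t∈⋂ with t∈⋂ a₀ a₀∈C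
  ... | σ₀ , _ , t∈σ₀ = σ₀ , σC⊑σ₀ , t∈σ₀
    where
    σC⊑σ₀ : _⊑_ AC σC σ₀
    σC⊑σ₀ a p with t∈⋂ a p
    ... | σ , σa⊑σ , t∈σ =
      trans (trans (sym (restrict1-self σC p)) (σa⊑σ a (x∈⁅x⁆ a))) (clear s σ σ₀ t t∈σ t∈σ₀ a)

  module _ (clear : Clear) where
    module Single = SCFDet succ (λ a → out ⁅ a ⁆)

    singleOut≐out : ∀ C s σC → Single.out C s σC ≐ out C s σC
    singleOut≐out C s σC with nonempty? C
    ... | yes (_ , a₀∈C) = out-⋂-restrict1 clear a₀∈C , λ t∈ a p → out-restrict1 a p t∈
    ... | no  C≠∅        = succ≐out s σC C≠∅

    singleAv⇔av : ∀ C s σC → Single.av C s σC ⇔ av C s σC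
    singleAv⇔av C s σC = ¬Empty-resp-≐ (singleOut≐out C s σC)

module _ {n : ℕ} {ST AC : Set} (sucS : ST → Pred ST 0ℓ)
         (outA : (a : Fin (suc n)) → ST → JA AC ⁅ a ⁆ → Pred ST 0ℓ) where
  open SCFDet sucS outA

  out-universal : (∀ s → Universal (sucS s)) → (∀ a s σa → Universal (outA a s σa)) →
                  ∀ C s σC → Universal (out C s σC)
  out-universal sucS-U outA-U C s σC t with nonempty? C
  ... | yes _ = λ a _ → outA-U a s _ t
  ... | no  _ = sucS-U s t

universalSCF : ∀ {n AP} (ST AC : Set) → ST → AC → SCF n AP
universalSCF ST AC s₀ x₀ = record
  { ST = ST ; AC = AC ; st₀ = s₀ ; ac₀ = x₀
  ; sucS = λ _ → U ; outA = λ _ _ _ → U ; L = λ _ → ∅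
  ; isSCF = λ _ _ → (λ _ → tt) , (λ _ → (λ _ _ → x₀) , tt)
  }

universalSCF-unclear : ∀ {n AP} {ST AC : Set} (s₀ : ST) {x y : AC} → x ≢ y →
                       ¬ GCFDet.Clear (SCFDetAG.toGCF (universalSCF {n} {AP} ST AC s₀ x))
universalSCF-unclear {n} {AP} {ST} {AC} s₀ {x} {y} x≢y clear =
  x≢y (clear s₀ (λ _ → x) (λ _ → y) s₀ (reaches (λ _ → x)) (reaches (λ _ → y)) zero)
  where
  reaches : ∀ σ → SCFDetAG.outAG (universalSCF {n} {AP} ST AC s₀ x) s₀ σ s₀
  reaches σ = out-universal (λ _ → U) (λ _ _ _ → U) (λ _ _ → tt) (λ _ _ _ _ → tt) ⊤ s₀ (λ a _ → σ a) s₀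

theorem5p4 :
    (∀ {n : ℕ} {AP : Set} (M : GCF n AP) → GCFDet.Clear M →
      IsSCF (GCF.ST M) (GCF.AC M) (GCFDet.succ M) (λ a → GCFDet.out M ⁅ a ⁆)
      × (∀ C s σC →
           (SCFDet.out (GCFDet.succ M) (λ a → GCFDet.out M ⁅ a ⁆) C s σC ≐ GCFDet.out M C s σC)
           × (SCFDet.av (GCFDet.succ M) (λ a → GCFDet.out M ⁅ a ⁆) C s σC ⇔ GCFDet.av M C s σC)))
    × (∀ (n : ℕ) (AP : Set) → Σ (SCF n AP) λ N → ¬ GCFDet.Clear (SCFDetAG.toGCF N))
theorem5p4 =
  (λ M clear → isSCF-singletonOut M
             , λ C s σC → singleOut≐out M clear C s σC , singleAv⇔av M clear C s σC)
  , λ n AP → universalSCF Unit Bool tt true , universalSCF-unclear {n} {AP} tt {true} {false} λ ()
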